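{- For all monadic models $\mathbb{D}_0,\mathbb{D}_1$ and every $k\in\mathbb{N}$, the following are equivalent: (1) $\mathbb{D}_0$ and $\mathbb{D}_1$ satisfy the same $\mathtt{ME}^\infty(A)$-sentences of quantifier rank at most $k$; (2) $\mathbb{D}_0\sim^\infty_k\mathbb{D}_1$; (3) player $\exists$ has a winning strategy in the game $\mathrm{EF}^\infty_k(\mathbb{D}_0,\mathbb{D}_1)$.
   Context: Fix a finite set $A$ of monadic predicate symbols. A monadic model is $(D,V)$ with $D$ a set (possibly empty) and $V:A\to\wp(D)$; the type of $d$ is $\{a: d\in V(a)\}$, and $|S|_{\mathbb{D}}$ is the number (cardinal) of elements of type $S\subseteq A$. $\mathtt{ME}^\infty(A)$: $\varphi::=\top\mid\bot\mid a(x)\mid\neg a(x)\mid x\approx y\mid x\not\approx y\mid\varphi\vee\varphi\mid\varphi\wedge\varphi\mid\exists x.\varphi\mid\forall x.\varphi\mid\exists^\infty x.\varphi\mid\forall^\infty x.\varphi$; on nonempty models semantics is standard with $\exists^\infty$ = "infinitely many", $\forall^\infty$ = "all but finitely many"; on the empty model $\exists,\exists^\infty$-sentences are false and $\forall,\forall^\infty$-sentences true. Quantifier rank: $0$ for atoms, max over $\wedge,\vee$, $+1$ per quantifier (of any of the four kinds). $\mathbb{D}\sim^\infty_0\mathbb{D}'$ always; for $k\ge1$, $\mathbb{D}\sim^\infty_k\mathbb{D}'$ iff for every $S\subseteq A$: $|S|_{\mathbb{D}}=|S|_{\mathbb{D}'}<k$, or $k\le|S|_{\mathbb{D}},|S|_{\mathbb{D}'}<\omega$,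 or both $|S|_{\mathbb{D}},|S|_{\mathbb{D}'}$ are infinite. Game $\mathrm{EF}^\infty_k(\mathbb{D}_0,\mathbb{D}_1)$: $k$ rounds; in each round $\forall$ chooses either a first-order move ($\forall$ picks $d_i\in D_i$ for some $i$, $\exists$ answers with $d_{1-i}\in D_{1-i}$) or a second-order move ($\forall$ picks an infinite $X_i\subseteq D_i$, $\exists$ answers with an infinite $X_{1-i}\subseteq D_{1-i}$, $\forall$ picks $d_{1-i}\in X_{1-i}$, $\exists$ answers with $d_i\in X_i$). The chosen elements extend the sequences; $\exists$ survives if not stuck and the map from chosen elements of $D_0$ to those of $D_1$ (position-wise) is a partial isomorphism (well-defined, injective, preserving and reflecting each $V(a)$). $\exists$ wins if she survives all $k$ rounds. -}

module Defs where

open import Data.Nat using (ℕ; zero; suc; _≤_; _<_; _⊔_)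
open import Data.Bool using (Bool; true; false)
open import Data.Fin using (Fin) renaming (zero to fzero; suc to fsuc)
open import Data.Fin.Subset using (Subset)
open import Data.Vec using (Vec; tabulate; []; _∷_; lookup)
open import Data.List using (List; length)
open import Data.List.Membership.Propositional using (_∈_)
open import Data.List.Relation.Unary.Unique.Propositional using (Unique)
open import Data.Product using (Σ; _×_; _,_)
open import Data.Sum using (_⊎_)
open import Data.Unit using (⊤)
open import Data.Empty using (⊥)
open import Relation.Nullary using (¬_)
open import Relation.Binary.PropositionalEquality using (_≡_; _≢_)
open import Function.Bundles using (_⇔_)

-- Monadic models over the finite signature A = Fin n.
-- V a d = true  iff  d ∈ V(a).  D may be empty.

record Model (n : ℕ) : Set₁ where
  field
    D : Set
    V : Fin n → D → Bool
open Model public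

typeOf : ∀ {n} (M : Model n) → D M → Subset n
typeOf M d = tabulate (λ a → V M a d)

Finite : {X : Set} → (X → Set) → Set
Finite {X} P = Σ (List X) (λ l → ∀ x → P x → x ∈ l)

Infinite : {X : Set} → (X → Set) → Set
Infinite P = ¬ Finite P

Mem : {X : Set} → (X → Bool) → X → Set
Mem χ x = χ x ≡ true

HasCard : ∀ {n} (M : Model n) → Subset n → ℕ → Set
HasCard M S m =
  Σ (List (D M)) (λ l → length l ≡ m × Unique l ×
     (∀ d → (typeOf M d ≡ S) ⇔ (d ∈ l)))

InfCard : ∀ {n} (M : Model n) → Subset n → Set
InfCard M S = Infinite (λ d → typeOf M d ≡ S)

SimClause : ∀ {n} → ℕ → Model n → Model n → Subset n → Set
SimClause k M₀ M₁ S =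
    (Σ ℕ (λ m → m < k × HasCard M₀ S m × HasCard M₁ S m))
  ⊎ ((Σ ℕ (λ m₀ → k ≤ m₀ × HasCard M₀ S m₀)) × (Σ ℕ (λ m₁ → k ≤ m₁ × HasCard M₁ S m₁)))
  ⊎ (InfCard M₀ S × InfCard M₁ S)

Sim∞ : ∀ {n} → ℕ → Model n → Model n → Set
Sim∞ zero    M₀ M₁ = ⊤
Sim∞ {n} (suc k) M₀ M₁ = ∀ (S : Subset n) → SimClause (suc k) M₀ M₁ S

-- Syntax of ME^∞(A): formulas with (de Bruijn) free variables in Fin m

data Formula (n : ℕ) : ℕ → Set where
  ⊤f ⊥f    : ∀ {m} → Formula n m
  pos neg  : ∀ {m} → Fin n → Fin m → Formula n m
  eq neq   : ∀ {m} → Fin m → Fin m → Formula n m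
  _∨f_ _∧f_ : ∀ {m} → Formula n m → Formula n m → Formula n m
  ∃f ∀f ∃∞f ∀∞f : ∀ {m} → Formula n (suc m) → Formula n m

Sentence : ℕ → Set
Sentence n = Formula n zero

qr : ∀ {n m} → Formula n m → ℕ
qr ⊤f = 0
qr ⊥f = 0
qr (pos a x) = 0
qr (neg a x) = 0
qr (eq x y) = 0
qr (neq x y) = 0
qr (φ ∨f ψ) = qr φ ⊔ qr ψ
qr (φ ∧f ψ) = qr φ ⊔ qr ψ
qr (∃f φ) = suc (qr φ)
qr (∀f φ) = suc (qr φ)
qr (∃∞f φ) = suc (qr φ)
qr (∀∞f φ) = suc (qr φ)

⟦_⟧ : ∀ {n m} → Formula n m → (M : Model n) → Vec (D M) m → Set
⟦ ⊤f ⟧ M ρ = ⊤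
⟦ ⊥f ⟧ M ρ = ⊥
⟦ pos a x ⟧ M ρ = V M a (lookup ρ x) ≡ true
⟦ neg a x ⟧ M ρ = V M a (lookup ρ x) ≡ false
⟦ eq x y ⟧ M ρ = lookup ρ x ≡ lookup ρ y
⟦ neq x y ⟧ M ρ = lookup ρ x ≢ lookup ρ y
⟦ φ ∨f ψ ⟧ M ρ = ⟦ φ ⟧ M ρ ⊎ ⟦ ψ ⟧ M ρ
⟦ φ ∧f ψ ⟧ M ρ = ⟦ φ ⟧ M ρ × ⟦ ψ ⟧ M ρ
⟦ ∃f φ ⟧ M ρ = Σ (D M) (λ d → ⟦ φ ⟧ M (d ∷ ρ))
⟦ ∀f φ ⟧ M ρ = ∀ d → ⟦ φ ⟧ M (d ∷ ρ)
⟦ ∃∞f φ ⟧ M ρ = Infinite (λ d → ⟦ φ ⟧ M (d ∷ ρ))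
⟦ ∀∞f φ ⟧ M ρ = Finite (λ d → ¬ ⟦ φ ⟧ M (d ∷ ρ))

_⊨_ : ∀ {n} → Model n → Sentence n → Set
M ⊨ φ = ⟦ φ ⟧ M []

SameTheory : ∀ {n} → ℕ → Model n → Model n → Set
SameTheory {n} k M₀ M₁ = ∀ (φ : Sentence n) → qr φ ≤ k → (M₀ ⊨ φ) ⇔ (M₁ ⊨ φ)

-- The game EF^∞_k.  A position is the pair of sequences of chosen
-- elements (position-wise corresponding).

PartialIso : ∀ {n j} (M₀ M₁ : Model n) → Vec (D M₀) j → Vec (D M₁) j → Set
PartialIso {n} {j} M₀ M₁ ā b̄ =
    (∀ (i i' : Fin j) → (lookup ā i ≡ lookup ā i') ⇔ (lookup b̄ i ≡ lookup b̄ i'))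
  × (∀ (i : Fin j) (a : Fin n) → V M₀ a (lookup ā i) ≡ V M₁ a (lookup b̄ i))

-- WinsFrom k ā b̄ : ∃ has a winning strategy in the remaining k rounds
-- from the position (ā , b̄).
WinsFrom : ∀ {n} (M₀ M₁ : Model n) → (k : ℕ) → ∀ {j} → Vec (D M₀) j → Vec (D M₁) j → Set
WinsFrom M₀ M₁ zero    ā b̄ = ⊤
WinsFrom M₀ M₁ (suc k) ā b̄ =
    (∀ (d₀ : D M₀) → Σ (D M₁) (λ d₁ → OK d₀ d₁))
  × (∀ (d₁ : D M₁) → Σ (D M₀) (λ d₀ → OK d₀ d₁))
  × (∀ (X₀ : D M₀ → Bool) → Infinite (Mem X₀) →
       Σ (D M₁ → Bool) (λ X₁ → Infinite (Mem X₁) ×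
         (∀ d₁ → Mem X₁ d₁ → Σ (D M₀) (λ d₀ → Mem X₀ d₀ × OK d₀ d₁))))
  × (∀ (X₁ : D M₁ → Bool) → Infinite (Mem X₁) →
       Σ (D M₀ → Bool) (λ X₀ → Infinite (Mem X₀) ×
         (∀ d₀ → Mem X₀ d₀ → Σ (D M₁) (λ d₁ → Mem X₁ d₁ × OK d₀ d₁))))
  where
  OK : D M₀ → D M₁ → Set
  OK d₀ d₁ = PartialIso M₀ M₁ (d₀ ∷ ā) (d₁ ∷ b̄) × WinsFrom M₀ M₁ k (d₀ ∷ ā) (d₁ ∷ b̄)

EFWin : ∀ {n} → ℕ → Model n → Model n → Set
EFWin k M₀ M₁ = WinsFrom M₀ M₁ k [] []

-- ∃ answers every move by an element that is either the partner of an
-- already chosen element or new and of the same type as ∀'s choice. Her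
-- invariant is that, for every type S, the sets of not yet chosen elements of
-- type S in the two models contain the same number of elements up to the
-- number of remaining rounds, and are either both infinite or both finite; at
-- the start this is exactly ~^∞_k. A second-order move X is answered through
-- a type S of which X has infinitely many new elements. Conversely, a winning
-- strategy transfers every formula of rank ≤ k by induction on the formula,
-- and the rank-m sentences "at least m elements have type S" together with
-- the rank-1 sentences "infinitely many elements have type S" determine ~^∞_k.
-- Excluded middle is needed for counting and for characteristic functions.
module Submission where

open import Defs
open import Data.Nat using (ℕ)
open import Data.Product using (_×_)
open import Function.Bundles using (_⇔_)
open import Axiom.ExcludedMiddle using (ExcludedMiddle)
open import Level using (0ℓ)

open import Axiom.DoubleNegationElimination using (em⇒dne)
open import Data.Bool using (Bool; true; false)
open import Data.Empty using (⊥-elim)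
open import Data.Fin using (Fin) renaming (zero to fzero; suc to fsuc)
open import Data.Fin.Properties using (∀-cons-⇔)
open import Data.Fin.Subset using (Subset)
open import Data.List using (List; []; _∷_; length; _++_; map; concatMap; filter; deduplicate)
open import Data.List.Membership.Propositional using (_∈_)
open import Data.List.Membership.Propositional.Properties
  using (∈-∃++; ∈-++⁺ˡ; ∈-++⁺ʳ; ∈-++⁻; ∈-map⁺; ∈-concatMap⁺; ∈-filter⁺; ∈-filter⁻; ∈-deduplicate⁺; ∈-deduplicate⁻)
open import Data.List.Properties using (length-++-sucʳ)
open import Data.List.Relation.Unary.All as All using (All; []; _∷_)
open import Data.List.Relation.Unary.Any as Any using (here; there)
open import Data.List.Relation.Unary.AllPairs using ([]; _∷_)
open import Data.List.Relation.Unary.Unique.Propositional using (Unique)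
import Data.List.Relation.Unary.Unique.DecPropositional.Properties as UniqueDec
open import Data.Nat using (zero; suc; _≤_; _<_; z≤n; s≤s; _⊔_; _<?_)
open import Data.Nat.Properties using (≤-refl; ≤-reflexive; ≤-trans; ≤-antisym; ≤-pred; n≤1+n; <⇒≤; ≮⇒≥; n≮n; m⊔n≤o⇒m≤o; m⊔n≤o⇒n≤o)
open import Data.Product using (Σ; ∃; ∃-syntax; _,_; proj₁; proj₂)
open import Data.Product.Function.NonDependent.Propositional using (_×-⇔_)
open import Data.Sum using (_⊎_; inj₁; inj₂)
open import Data.Sum.Function.Propositional using (_⊎-⇔_)
open import Data.Unit using (tt)
open import Data.Vec using (Vec; []; _∷_; lookup; tabulate; toList)
open import Data.Vec.Membership.Propositional.Properties using (∈-lookup; ∈-toList⁺)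
open import Data.Vec.Properties using (lookup∘tabulate; tabulate∘lookup; tabulate-cong)
open import Function using (_∘_; flip)
open import Function.Bundles using (mk⇔; Equivalence)
import Function.Properties.Equivalence as ⇔
open import Relation.Binary using (_⇒_; DecidableEquality)
open import Relation.Binary.PropositionalEquality using (_≡_; _≢_; refl; sym; trans; cong; cong₂; subst)
open import Relation.Nullary using (¬_; yes; no; does)
open import Relation.Unary using (Pred; Decidable; _⊆_; _≐_; ∁; _∩_; _∖_)
open import Relation.Unary.Properties using (≐-sym; ≐-trans)

open Equivalence using (to; from)

private
  variable
    X Y : Set
    P Q : Pred X 0ℓ
    K m m′ : ℕ

-- Counting the elements of a predicate

unique-⊆⇒length≤ : ∀ {l l′ : List X} → Unique l → (∀ {x} → x ∈ l → x ∈ l′) → length l ≤ length l′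
unique-⊆⇒length≤ {l = []} _ _ = z≤n
unique-⊆⇒length≤ {l = x ∷ l} (x∉l ∷ u) l⊆l′ with ∈-∃++ (l⊆l′ (here refl))
... | ys , zs , refl =
  subst (suc (length l) ≤_) (sym (length-++-sucʳ ys x zs)) (s≤s (unique-⊆⇒length≤ u l⊆ys++zs))
  where
  l⊆ys++zs : ∀ {y} → y ∈ l → y ∈ ys ++ zs
  l⊆ys++zs y∈l with ∈-++⁻ ys (l⊆l′ (there y∈l))
  ... | inj₁ y∈ys = ∈-++⁺ˡ y∈ys
  ... | inj₂ (here refl) = ⊥-elim (All.lookup x∉l y∈l refl)
  ... | inj₂ (there y∈zs) = ∈-++⁺ʳ ys y∈zs

AtLeast : Pred X 0ℓ → ℕ → Set
AtLeast {X} P m = Σ (List X) λ l → m ≤ length l × Unique l × All P l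

Card : Pred X 0ℓ → ℕ → Set
Card {X} P m = Σ (List X) λ l → length l ≡ m × Unique l × (∀ x → P x ⇔ x ∈ l)

AtLeast-mono : P ⊆ Q → AtLeast P m → AtLeast Q m
AtLeast-mono P⊆Q (l , m≤ , u , ps) = l , m≤ , u , All.map P⊆Q ps

AtLeast-cong : P ≐ Q → AtLeast P m ⇔ AtLeast Q m
AtLeast-cong (P⊆Q , Q⊆P) = mk⇔ (AtLeast-mono P⊆Q) (AtLeast-mono Q⊆P)

Finite-antimono : P ⊆ Q → Finite Q → Finite P
Finite-antimono P⊆Q (l , cover) = l , λ x px → cover x (P⊆Q px)

Infinite-mono : P ⊆ Q → Infinite P → Infinite Q
Infinite-mono P⊆Q ∞P = ∞P ∘ Finite-antimono P⊆Q

Infinite-cong : P ≐ Q → Infinite P ⇔ Infinite Q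
Infinite-cong (P⊆Q , Q⊆P) = mk⇔ (Infinite-mono P⊆Q) (Infinite-mono Q⊆P)

Card⇒AtLeast : Card P m → m′ ≤ m → AtLeast P m′
Card⇒AtLeast (l , refl , u , mem) m′≤ = l , m′≤ , u , All.tabulate (from (mem _))

AtLeast⇒≤Card : Card P m → AtLeast P m′ → m′ ≤ m
AtLeast⇒≤Card (l , refl , _ , mem) (l′ , m′≤ , u′ , ps) =
  ≤-trans m′≤ (unique-⊆⇒length≤ u′ (λ x∈l′ → to (mem _) (All.lookup ps x∈l′)))

Card⇒Finite : Card P m → Finite P
Card⇒Finite (l , _ , _ , mem) = l , λ x → to (mem x)

AtLeast-suc : AtLeast P (suc m) ⇔ (∃[ x ] P x × AtLeast (P ∩ (x ≢_)) m)
AtLeast-suc {P = P} = mk⇔ split join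
  where
  split : AtLeast P (suc m) → ∃[ x ] P x × AtLeast (P ∩ (x ≢_)) m
  split ([] , () , _)
  split (x ∷ l , s≤s m≤ , x∉l ∷ u , px ∷ ps) = x , px , l , m≤ , u , All.zip (ps , x∉l)
  join : (∃[ x ] P x × AtLeast (P ∩ (x ≢_)) m) → AtLeast P (suc m)
  join (x , px , l , m≤ , u , ps) = x ∷ l , s≤s m≤ , All.map proj₂ ps ∷ u , px ∷ All.map proj₁ ps

Finite-≡ : (x : X) → Finite (x ≡_)
Finite-≡ x = x ∷ [] , λ { _ refl → here refl }

Finite-fibres : (f : X → Y) (ys : List Y) → (∀ y → y ∈ ys) →
                (∀ y → Finite (P ∩ (λ x → f x ≡ y))) → Finite P
Finite-fibres {P = P} f ys complete fin = concatMap (proj₁ ∘ fin) ys , cover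
  where
  cover : ∀ x → P x → x ∈ concatMap (proj₁ ∘ fin) ys
  cover x px = ∈-concatMap⁺ (proj₁ ∘ fin) (Any.map (λ { refl → proj₂ (fin (f x)) x (px , refl) }) (complete (f x)))

CountEquiv : ℕ → Pred X 0ℓ → Pred Y 0ℓ → Set
CountEquiv K P Q = (∀ m → m ≤ K → AtLeast P m ⇔ AtLeast Q m) × (Infinite P ⇔ Infinite Q)

-- SimClause k M₀ M₁ S unfolds to CountClause k (OfType M₀ S) (OfType M₁ S).
CountClause : ℕ → Pred X 0ℓ → Pred Y 0ℓ → Set
CountClause K P Q =
    (Σ ℕ λ m → m < K × Card P m × Card Q m)
  ⊎ ((Σ ℕ λ m₀ → K ≤ m₀ × Card P m₀) × (Σ ℕ λ m₁ → K ≤ m₁ × Card Q m₁))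
  ⊎ (Infinite P × Infinite Q)

CountEquiv-sym : CountEquiv K P Q → CountEquiv K Q P
CountEquiv-sym (atLeast , infinite) = (λ m m≤K → ⇔.sym (atLeast m m≤K)) , ⇔.sym infinite

CountEquiv-≤ : m ≤ K → CountEquiv K P Q → CountEquiv m P Q
CountEquiv-≤ m≤K (atLeast , infinite) = (λ m′ m′≤m → atLeast m′ (≤-trans m′≤m m≤K)) , infinite

CountEquiv-cong : {P P′ : Pred X 0ℓ} {Q Q′ : Pred Y 0ℓ} →
                  P ≐ P′ → Q ≐ Q′ → CountEquiv K P Q → CountEquiv K P′ Q′
CountEquiv-cong P≐P′ Q≐Q′ (atLeast , infinite) =
    (λ m m≤K → ⇔.trans (⇔.trans (AtLeast-cong (≐-sym P≐P′)) (atLeast m m≤K)) (AtLeast-cong Q≐Q′))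
  , ⇔.trans (⇔.trans (Infinite-cong (≐-sym P≐P′)) infinite) (Infinite-cong Q≐Q′)

-- Back-and-forth relations

Forth : (X → Y → Set) → Set
Forth R = ∀ x → ∃ (R x)

InfiniteForth : (X → Y → Set) → Set
InfiniteForth {X} {Y} R =
  ∀ (A : X → Bool) → Infinite (Mem A) →
  Σ (Y → Bool) λ B → Infinite (Mem B) × (∀ y → Mem B y → Σ X λ x → Mem A x × R x y)

BackAndForth : (X → Y → Set) → Set
BackAndForth R = Forth R × Forth (flip R) × InfiniteForth R × InfiniteForth (flip R)

module _ {R R′ : X → Y → Set} (R⇒R′ : R ⇒ R′) where

  Forth-map : Forth R → Forth R′
  Forth-map forth x = let (y , r) = forth x in y , R⇒R′ r

  InfiniteForth-map : InfiniteForth R → InfiniteForth R′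
  InfiniteForth-map forth A ∞A =
    let (B , ∞B , partner) = forth A ∞A
    in B , ∞B , λ y y∈B → let (x , x∈A , r) = partner y y∈B in x , x∈A , R⇒R′ r

BackAndForth-map : {R R′ : X → Y → Set} → R ⇒ R′ → BackAndForth R → BackAndForth R′
BackAndForth-map R⇒R′ (forth , back , ∞forth , ∞back) =
  Forth-map R⇒R′ forth , Forth-map R⇒R′ back , InfiniteForth-map R⇒R′ ∞forth , InfiniteForth-map R⇒R′ ∞back

module _ {R : X → Y → Set} where

  ∃-⇔ : BackAndForth R → (∀ {x y} → R x y → P x ⇔ Q y) → ∃ P ⇔ ∃ Q
  ∃-⇔ (forth , back , _ , _) R⇒⇔ = mk⇔
    (λ (x , px) → let (y , r) = forth x in y , to (R⇒⇔ r) px)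
    (λ (y , qy) → let (x , r) = back y in x , from (R⇒⇔ r) qy)

  ∀-⇔ : BackAndForth R → (∀ {x y} → R x y → P x ⇔ Q y) → (∀ x → P x) ⇔ (∀ y → Q y)
  ∀-⇔ (forth , back , _ , _) R⇒⇔ = mk⇔
    (λ ∀P y → let (x , r) = back y in to (R⇒⇔ r) (∀P x))
    (λ ∀Q x → let (y , r) = forth x in from (R⇒⇔ r) (∀Q y))

-- Types and new elements

allSubsets : ∀ n → List (Subset n)
allSubsets zero    = [] ∷ []
allSubsets (suc n) = map (true ∷_) (allSubsets n) ++ map (false ∷_) (allSubsets n)

∈-allSubsets : ∀ {n} (S : Subset n) → S ∈ allSubsets n
∈-allSubsets []                  = here refl
∈-allSubsets (true ∷ S)          = ∈-++⁺ˡ (∈-map⁺ (true ∷_) (∈-allSubsets S))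
∈-allSubsets {suc n} (false ∷ S) = ∈-++⁺ʳ (map (true ∷_) (allSubsets n)) (∈-map⁺ (false ∷_) (∈-allSubsets S))

Occurs : ∀ {j} → Vec X j → Pred X 0ℓ
Occurs ā x = ∃[ i ] lookup ā i ≡ x

Occurs-finite : ∀ {j} (ā : Vec X j) → Finite (Occurs ā)
Occurs-finite ā = toList ā , λ { _ (i , refl) → ∈-toList⁺ (∈-lookup i ā) }

∩-≢-absent : ∀ {d} → ¬ P d → P ∩ (d ≢_) ≐ P
∩-≢-absent ¬pd = proj₁ , λ px → px , λ { refl → ¬pd px }

module _ {n : ℕ} (M : Model n) where

  OfType : Subset n → Pred (D M) 0ℓ
  OfType S d = typeOf M d ≡ S

  Fresh : ∀ {j} → Subset n → Vec (D M) j → Pred (D M) 0ℓ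
  Fresh S ā = OfType S ∖ Occurs ā

  V≡lookup-typeOf : ∀ a d → V M a d ≡ lookup (typeOf M d) a
  V≡lookup-typeOf a d = sym (lookup∘tabulate (λ a → V M a d) a)

  V⇔typeOf : ∀ {d S} → (∀ a → V M a d ≡ lookup S a) ⇔ OfType S d
  V⇔typeOf {d} {S} = mk⇔
    (λ sameV → trans (tabulate-cong sameV) (tabulate∘lookup S))
    (λ t a → trans (V≡lookup-typeOf a d) (cong (λ S → lookup S a) t))

  module _ {S : Subset n} where

    Fresh-[] : Fresh S [] ≐ OfType S
    Fresh-[] = proj₁ , λ t → t , λ { (() , _) }

    Fresh-∷ : ∀ {j d} {ā : Vec (D M) j} → Fresh S (d ∷ ā) ≐ Fresh S ā ∩ (d ≢_)
    Fresh-∷ =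
        (λ (t , new) → (t , λ (i , ā[i]≡x) → new (fsuc i , ā[i]≡x)) , λ d≡x → new (fzero , d≡x))
      , (λ ((t , new) , d≢x) → t , λ { (fzero , d≡x) → d≢x d≡x ; (fsuc i , ā[i]≡x) → new (i , ā[i]≡x) })

    Fresh-∷-absent : ∀ {j d} {ā : Vec (D M) j} → ¬ Fresh S ā d → Fresh S (d ∷ ā) ≐ Fresh S ā
    Fresh-∷-absent ¬fresh = ≐-trans Fresh-∷ (∩-≢-absent ¬fresh)

typeOf≡⇒V≡ : ∀ {n} {M₀ M₁ : Model n} {d e} → typeOf M₀ d ≡ typeOf M₁ e → ∀ a → V M₀ a d ≡ V M₁ a e
typeOf≡⇒V≡ {M₀ = M₀} {M₁} {d} {e} sameType a =
  trans (V≡lookup-typeOf M₀ a d) (trans (cong (λ S → lookup S a) sameType) (sym (V≡lookup-typeOf M₁ a e)))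

Admissible : ∀ {n} (M₀ M₁ : Model n) {j} → Vec (D M₀) j → Vec (D M₁) j → D M₀ → D M₁ → Set
Admissible M₀ M₁ ā b̄ d e =
    (∃[ i ] lookup ā i ≡ d × lookup b̄ i ≡ e)
  ⊎ (∃[ S ] Fresh M₀ S ā d × Fresh M₁ S b̄ e)

module _ {n} {M₀ M₁ : Model n} {j} {ā : Vec (D M₀) j} {b̄ : Vec (D M₁) j} where

  Admissible-sym : ∀ {d e} → Admissible M₁ M₀ b̄ ā e d → Admissible M₀ M₁ ā b̄ d e
  Admissible-sym (inj₁ (i , b̄[i]≡e , ā[i]≡d)) = inj₁ (i , ā[i]≡d , b̄[i]≡e)
  Admissible-sym (inj₂ (S , fresh₁ , fresh₀)) = inj₂ (S , fresh₀ , fresh₁)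

  PartialIso-∷ : ∀ {d e} → Admissible M₀ M₁ ā b̄ d e → PartialIso M₀ M₁ ā b̄ →
                 PartialIso M₀ M₁ (d ∷ ā) (e ∷ b̄)
  PartialIso-∷ (inj₁ (p , refl , refl)) (sameEq , sameV) = sameEq′ , sameV′
    where
    sameEq′ : ∀ i i′ → _
    sameEq′ fzero    fzero     = mk⇔ (λ _ → refl) (λ _ → refl)
    sameEq′ fzero    (fsuc i′) = sameEq p i′
    sameEq′ (fsuc i) fzero     = sameEq i p
    sameEq′ (fsuc i) (fsuc i′) = sameEq i i′
    sameV′ : ∀ i a → _
    sameV′ fzero    = sameV p
    sameV′ (fsuc i) = sameV i
  PartialIso-∷ (inj₂ (S , (t₀ , new₀) , (t₁ , new₁))) (sameEq , sameV) = sameEq′ , sameV′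
    where
    sameEq′ : ∀ i i′ → _
    sameEq′ fzero    fzero     = mk⇔ (λ _ → refl) (λ _ → refl)
    sameEq′ fzero    (fsuc i′) = mk⇔ (λ d≡ → ⊥-elim (new₀ (i′ , sym d≡))) (λ e≡ → ⊥-elim (new₁ (i′ , sym e≡)))
    sameEq′ (fsuc i) fzero     = mk⇔ (λ ≡d → ⊥-elim (new₀ (i , ≡d))) (λ ≡e → ⊥-elim (new₁ (i , ≡e)))
    sameEq′ (fsuc i) (fsuc i′) = sameEq i i′
    sameV′ : ∀ i a → _
    sameV′ fzero    = typeOf≡⇒V≡ {M₀ = M₀} {M₁} (trans t₀ (sym t₁))
    sameV′ (fsuc i) = sameV i

PartialIso-[] : ∀ {n} (M₀ M₁ : Model n) → PartialIso M₀ M₁ [] []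
PartialIso-[] M₀ M₁ = (λ ()) , λ ()

FreshCountEquiv : ∀ {n} (M₀ M₁ : Model n) → ℕ → ∀ {j} → Vec (D M₀) j → Vec (D M₁) j → Set
FreshCountEquiv {n} M₀ M₁ K ā b̄ = ∀ (S : Subset n) → CountEquiv K (Fresh M₀ S ā) (Fresh M₁ S b̄)

-- Formulas counting the elements of a type

module _ {n : ℕ} where

  ⋀ : ∀ {m j} → (Fin m → Formula n j) → Formula n j
  ⋀ {zero}  φ = ⊤f
  ⋀ {suc m} φ = φ fzero ∧f ⋀ (φ ∘ fsuc)

  literal : ∀ {j} → Bool → Fin n → Fin j → Formula n j
  literal true  = pos
  literal false = neg

  hasType : ∀ {j} → Subset n → Fin j → Formula n j
  hasType S x = ⋀ λ a → literal (lookup S a) a x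

  freshOfType : ∀ {j} → Subset n → Formula n (suc j)
  freshOfType S = hasType S fzero ∧f ⋀ λ i → neq fzero (fsuc i)

  atLeast : ∀ {j} → Subset n → ℕ → Formula n j
  atLeast S zero    = ⊤f
  atLeast S (suc m) = ∃f (freshOfType S ∧f atLeast S m)

  qr-⋀ : ∀ {m j} {φ : Fin m → Formula n j} → (∀ i → qr (φ i) ≡ 0) → qr (⋀ φ) ≡ 0
  qr-⋀ {zero}  _    = refl
  qr-⋀ {suc m} qr≡0 = cong₂ _⊔_ (qr≡0 fzero) (qr-⋀ (qr≡0 ∘ fsuc))

  qr-literal : ∀ {j} b a (x : Fin j) → qr (literal b a x) ≡ 0
  qr-literal true  a x = refl
  qr-literal false a x = refl

  qr-freshOfType : ∀ {j} (S : Subset n) → qr (freshOfType {j} S) ≡ 0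
  qr-freshOfType {j} S = cong₂ _⊔_ (qr-⋀ λ a → qr-literal (lookup S a) a fzero) (qr-⋀ {m = j} λ _ → refl)

  qr-atLeast : ∀ {j} (S : Subset n) m → qr (atLeast {j} S m) ≡ m
  qr-atLeast S zero    = refl
  qr-atLeast S (suc m) = cong suc (cong₂ _⊔_ (qr-freshOfType S) (qr-atLeast S m))

  module _ (M : Model n) where

    ⟦⋀⟧ : ∀ {m j} {φ : Fin m → Formula n j} {ρ} → ⟦ ⋀ φ ⟧ M ρ ⇔ (∀ i → ⟦ φ i ⟧ M ρ)
    ⟦⋀⟧ {zero}  = mk⇔ (λ _ ()) (λ _ → tt)
    ⟦⋀⟧ {suc m} = ⇔.trans (⇔.refl ×-⇔ ⟦⋀⟧) ∀-cons-⇔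

    ⟦literal⟧ : ∀ {j} b a (x : Fin j) ρ → ⟦ literal b a x ⟧ M ρ ⇔ (V M a (lookup ρ x) ≡ b)
    ⟦literal⟧ true  a x ρ = ⇔.refl
    ⟦literal⟧ false a x ρ = ⇔.refl

    ⟦hasType⟧ : ∀ {j} S (x : Fin j) ρ → ⟦ hasType S x ⟧ M ρ ⇔ OfType M S (lookup ρ x)
    ⟦hasType⟧ S x ρ = ⇔.trans ⟦⋀⟧ (⇔.trans literals (V⇔typeOf M))
      where
      literals : (∀ a → ⟦ literal (lookup S a) a x ⟧ M ρ) ⇔ (∀ a → V M a (lookup ρ x) ≡ lookup S a)
      literals = mk⇔ (λ h a → to (⟦literal⟧ _ a x ρ) (h a)) (λ h a → from (⟦literal⟧ _ a x ρ) (h a))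

    ⟦freshOfType⟧ : ∀ {j} S (ρ : Vec (D M) j) → (λ d → ⟦ freshOfType S ⟧ M (d ∷ ρ)) ≐ Fresh M S ρ
    ⟦freshOfType⟧ S ρ =
        (λ (t , new) → to (⟦hasType⟧ S fzero _) t , λ (i , ρ[i]≡d) → to ⟦⋀⟧ new i (sym ρ[i]≡d))
      , (λ (t , new) → from (⟦hasType⟧ S fzero _) t , from ⟦⋀⟧ λ i d≡ρ[i] → new (i , sym d≡ρ[i]))

    ⟦atLeast⟧ : ∀ S m {j} (ρ : Vec (D M) j) → ⟦ atLeast S m ⟧ M ρ ⇔ AtLeast (Fresh M S ρ) m
    ⟦atLeast⟧ S zero    ρ = mk⇔ (λ _ → [] , z≤n , [] , []) (λ _ → tt)
    ⟦atLeast⟧ S (suc m) ρ = mk⇔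
      (λ (d , fresh , more) → from AtLeast-suc
         (d , proj₁ (⟦freshOfType⟧ S ρ) fresh , AtLeast-mono (proj₁ (Fresh-∷ M)) (to (⟦atLeast⟧ S m (d ∷ ρ)) more)))
      (λ atLeast → let (d , fresh , more) = to AtLeast-suc atLeast in
         d , proj₂ (⟦freshOfType⟧ S ρ) fresh , from (⟦atLeast⟧ S m (d ∷ ρ)) (AtLeast-mono (proj₂ (Fresh-∷ M)) more))

module Classical (em : ExcludedMiddle 0ℓ) where

  private
    dne : {A : Set} → ¬ ¬ A → A
    dne = em⇒dne em

  χ : Pred X 0ℓ → X → Bool
  χ P x = does (em {P x})

  Mem-χ : Mem (χ P) ≐ P
  Mem-χ {P = P} = sound , complete
    where
    sound : Mem (χ P) ⊆ P
    sound {x} with em {P x}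
    ... | yes px = λ _ → px
    ... | no _   = λ ()
    complete : P ⊆ Mem (χ P)
    complete {x} px with em {P x}
    ... | yes _   = refl
    ... | no ¬px  = ⊥-elim (¬px px)

  Finite⇒Card : Finite P → ∃ (Card P)
  Finite⇒Card {X} {P} (l , cover) = length l′ , l′ , refl , UniqueDec.deduplicate-! _≟_ (filter P? l) , mem
    where
    _≟_ : DecidableEquality X
    _ ≟ _ = em
    P? : Decidable P
    P? _ = em
    l′ : List X
    l′ = deduplicate _≟_ (filter P? l)
    mem : ∀ x → P x ⇔ x ∈ l′
    mem x = mk⇔ (λ px → ∈-deduplicate⁺ _≟_ (∈-filter⁺ P? (cover x px) px))
                (λ x∈l′ → proj₂ (∈-filter⁻ P? {xs = l} (∈-deduplicate⁻ _≟_ (filter P? l) x∈l′)))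

  Finite-split : Finite Q → Finite (P ∖ Q) → Finite P
  Finite-split {Q = Q} {P = P} (lQ , coverQ) (l , cover) = lQ ++ l , cover′
    where
    cover′ : ∀ x → P x → x ∈ lQ ++ l
    cover′ x px with em {Q x}
    ... | yes qx  = ∈-++⁺ˡ (coverQ x qx)
    ... | no ¬qx = ∈-++⁺ʳ lQ (cover x (px , ¬qx))

  Infinite-∖ : Finite Q → Infinite P → Infinite (P ∖ Q)
  Infinite-∖ finQ ∞P = ∞P ∘ Finite-split finQ

  Infinite-remove : ∀ {d} → Infinite P ⇔ Infinite (P ∩ (d ≢_))
  Infinite-remove {d = d} = mk⇔ (Infinite-∖ (Finite-≡ d)) (Infinite-mono proj₁)

  Infinite⇒nonempty : Infinite P → ∃ P
  Infinite⇒nonempty ∞P = dne λ ∄P → ∞P ([] , λ x px → ⊥-elim (∄P (x , px)))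

  Infinite⇒AtLeast : Infinite P → ∀ m → AtLeast P m
  Infinite⇒AtLeast ∞P zero    = [] , z≤n , [] , []
  Infinite⇒AtLeast ∞P (suc m) =
    let (x , px) = Infinite⇒nonempty ∞P
    in from AtLeast-suc (x , px , Infinite⇒AtLeast (to Infinite-remove ∞P) m)

  Infinite⇒infiniteFibre : (f : X → Y) (ys : List Y) → (∀ y → y ∈ ys) →
                           Infinite P → ∃[ y ] Infinite (P ∩ (λ x → f x ≡ y))
  Infinite⇒infiniteFibre f ys complete ∞P =
    dne λ noFibre → ∞P (Finite-fibres f ys complete λ y → dne λ ∞fibre → noFibre (y , ∞fibre))

  AtLeast-remove : ∀ {d} → P d → AtLeast (P ∩ (d ≢_)) m ⇔ AtLeast P (suc m)
  AtLeast-remove {X} {d = d} pd = mk⇔ (λ atLeast → from AtLeast-suc (d , pd , atLeast)) shrink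
    where
    drop : ∀ {P : Pred X 0ℓ} l → Unique l → All P l →
           Σ (List X) λ l′ → length l ≤ suc (length l′) × Unique l′ × All (P ∩ (d ≢_)) l′
    drop [] [] [] = [] , z≤n , [] , []
    drop (y ∷ l) (y∉l ∷ u) (py ∷ ps) with em {d ≡ y}
    ... | yes refl = l , ≤-refl , u , All.zip (ps , y∉l)
    ... | no d≢y   =
      let (l′ , len , u′ , ps′) = drop l u (All.zip (ps , y∉l))
      in y ∷ l′ , s≤s len , All.map (proj₂ ∘ proj₁) ps′ ∷ u′ , (py , d≢y) ∷ All.map (λ ((p , _) , q) → p , q) ps′
    shrink : AtLeast _ (suc _) → AtLeast _ _
    shrink (l , m<l , u , ps) = let (l′ , len , u′ , ps′) = drop l u ps in l′ , ≤-pred (≤-trans m<l len) , u′ , ps′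

  CountEquiv-remove : ∀ {d e} → P d → Q e → CountEquiv (suc K) P Q → CountEquiv K (P ∩ (d ≢_)) (Q ∩ (e ≢_))
  CountEquiv-remove pd qe (atLeast , infinite) =
      (λ m m≤K → ⇔.trans (AtLeast-remove pd) (⇔.trans (atLeast (suc m) (s≤s m≤K)) (⇔.sym (AtLeast-remove qe))))
    , ⇔.trans (⇔.sym Infinite-remove) (⇔.trans infinite Infinite-remove)

  CountEquiv-≤Card : CountEquiv K P Q → ∀ {m₀ m₁} → Card P m₀ → Card Q m₁ → ∀ {m} → m ≤ K → m ≤ m₀ → m ≤ m₁
  CountEquiv-≤Card (atLeast , _) c₀ c₁ {m} m≤K m≤m₀ = AtLeast⇒≤Card c₁ (to (atLeast m m≤K) (Card⇒AtLeast c₀ m≤m₀))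

  CountEquiv⇒CountClause : CountEquiv K P Q → CountClause K P Q
  CountEquiv⇒CountClause {K} {P = P} {Q = Q} equiv@(_ , infinite) with em {Infinite P}
  ... | yes ∞P = inj₂ (inj₂ (∞P , to infinite ∞P))
  ... | no ¬∞P with Finite⇒Card (dne ¬∞P) | Finite⇒Card (dne (¬∞P ∘ from infinite))
  ... | m₀ , c₀ | m₁ , c₁ with m₀ <? K
  ... | yes m₀<K = inj₁ (m₀ , m₀<K , c₀ , subst (Card Q) (≤-antisym m₁≤m₀ m₀≤m₁) c₁)
    where
    m₀≤m₁ : m₀ ≤ m₁
    m₀≤m₁ = CountEquiv-≤Card equiv c₀ c₁ (<⇒≤ m₀<K) ≤-refl
    m₁≤m₀ : m₁ ≤ m₀
    m₁≤m₀ = ≮⇒≥ λ m₀<m₁ → n≮n m₀ (CountEquiv-≤Card (CountEquiv-sym equiv) c₁ c₀ m₀<K m₀<m₁)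
  ... | no m₀≮K = inj₂ (inj₁ ((m₀ , K≤m₀ , c₀) , (m₁ , CountEquiv-≤Card equiv c₀ c₁ ≤-refl K≤m₀ , c₁)))
    where
    K≤m₀ : K ≤ m₀
    K≤m₀ = ≮⇒≥ m₀≮K

  CountClause⇒CountEquiv : CountClause K P Q → CountEquiv K P Q
  CountClause⇒CountEquiv (inj₁ (_ , _ , c₀ , c₁)) =
      (λ _ _ → mk⇔ (Card⇒AtLeast c₁ ∘ AtLeast⇒≤Card c₀) (Card⇒AtLeast c₀ ∘ AtLeast⇒≤Card c₁))
    , mk⇔ (λ ∞P → ⊥-elim (∞P (Card⇒Finite c₀))) (λ ∞Q → ⊥-elim (∞Q (Card⇒Finite c₁)))
  CountClause⇒CountEquiv (inj₂ (inj₁ ((_ , K≤m₀ , c₀) , (_ , K≤m₁ , c₁)))) =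
      (λ _ m≤K → mk⇔ (λ _ → Card⇒AtLeast c₁ (≤-trans m≤K K≤m₁)) (λ _ → Card⇒AtLeast c₀ (≤-trans m≤K K≤m₀)))
    , mk⇔ (λ ∞P → ⊥-elim (∞P (Card⇒Finite c₀))) (λ ∞Q → ⊥-elim (∞Q (Card⇒Finite c₁)))
  CountClause⇒CountEquiv (inj₂ (inj₂ (∞P , ∞Q))) =
    (λ m _ → mk⇔ (λ _ → Infinite⇒AtLeast ∞Q m) (λ _ → Infinite⇒AtLeast ∞P m)) , mk⇔ (λ _ → ∞Q) (λ _ → ∞P)

  Infinite-forth : {R : X → Y → Set} → InfiniteForth R → (∀ {x y} → R x y → P x → Q y) → Infinite P → Infinite Q
  Infinite-forth {P = P} forth R⇒ ∞P =
    let A≐P = Mem-χ {P = P}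
        (B , ∞B , partner) = forth (χ P) (Infinite-mono (proj₂ A≐P) ∞P)
    in Infinite-mono (λ {y} y∈B → let (x , x∈A , r) = partner y y∈B in R⇒ r (proj₁ A≐P x∈A)) ∞B

  Cofinite-forth : {R : X → Y → Set} → InfiniteForth (flip R) → (∀ {x y} → R x y → P x → Q y) →
                   Finite (∁ P) → Finite (∁ Q)
  Cofinite-forth back R⇒ finP = dne λ ∞¬Q → Infinite-forth back (λ r ¬qy px → ¬qy (R⇒ r px)) ∞¬Q finP

  module _ {R : X → Y → Set} (bf : BackAndForth R) (R⇒⇔ : ∀ {x y} → R x y → P x ⇔ Q y) where

    private
      ∞forth = proj₁ (proj₂ (proj₂ bf))
      ∞back  = proj₂ (proj₂ (proj₂ bf))

    Infinite-⇔ : Infinite P ⇔ Infinite Q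
    Infinite-⇔ = mk⇔ (Infinite-forth ∞forth (λ r → to (R⇒⇔ r))) (Infinite-forth ∞back (λ r → from (R⇒⇔ r)))

    Cofinite-⇔ : Finite (∁ P) ⇔ Finite (∁ Q)
    Cofinite-⇔ = mk⇔ (Cofinite-forth ∞back (λ r → to (R⇒⇔ r))) (Cofinite-forth ∞forth (λ r → from (R⇒⇔ r)))

  -- ∃'s strategy

  module _ {n} (M₀ M₁ : Model n) {j} {ā : Vec (D M₀) j} {b̄ : Vec (D M₁) j} where

    Admissible⇒freshTogether : ∀ {d e} → Admissible M₀ M₁ ā b̄ d e → ∀ S →
      (Fresh M₀ S ā d × Fresh M₁ S b̄ e) ⊎ (¬ Fresh M₀ S ā d × ¬ Fresh M₁ S b̄ e)
    Admissible⇒freshTogether (inj₁ (i , ā[i]≡d , b̄[i]≡e)) S =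
      inj₂ ((λ (_ , new) → new (i , ā[i]≡d)) , (λ (_ , new) → new (i , b̄[i]≡e)))
    Admissible⇒freshTogether (inj₂ (S′ , fresh₀ , fresh₁)) S with em {S′ ≡ S}
    ... | yes refl = inj₁ (fresh₀ , fresh₁)
    ... | no S′≢S  = inj₂ ( (λ (t , _) → S′≢S (trans (sym (proj₁ fresh₀)) t))
                          , (λ (t , _) → S′≢S (trans (sym (proj₁ fresh₁)) t)))

    FreshCountEquiv-∷ : ∀ {k d e} → Admissible M₀ M₁ ā b̄ d e →
      FreshCountEquiv M₀ M₁ (suc k) ā b̄ → FreshCountEquiv M₀ M₁ k (d ∷ ā) (e ∷ b̄)
    FreshCountEquiv-∷ {k} adm equiv S with Admissible⇒freshTogether adm S
    ... | inj₁ (fresh₀ , fresh₁) =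
      CountEquiv-cong (≐-sym (Fresh-∷ M₀)) (≐-sym (Fresh-∷ M₁)) (CountEquiv-remove fresh₀ fresh₁ (equiv S))
    ... | inj₂ (¬fresh₀ , ¬fresh₁) =
      CountEquiv-cong (≐-sym (Fresh-∷-absent M₀ ¬fresh₀)) (≐-sym (Fresh-∷-absent M₁ ¬fresh₁))
        (CountEquiv-≤ (n≤1+n k) (equiv S))

    admissible-forth : ∀ {K} → FreshCountEquiv M₀ M₁ (suc K) ā b̄ → Forth (Admissible M₀ M₁ ā b̄)
    admissible-forth equiv d with em {Occurs ā d}
    ... | yes (i , ā[i]≡d) = lookup b̄ i , inj₁ (i , ā[i]≡d , refl)
    ... | no new =
      let S = typeOf M₀ d
          one₀ = from AtLeast-suc (d , (refl , new) , [] , z≤n , [] , [])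
          (e , fresh₁ , _) = to AtLeast-suc (to (proj₁ (equiv S) 1 (s≤s z≤n)) one₀)
      in e , inj₂ (S , (refl , new) , fresh₁)

    -- ∀'s infinite set has infinitely many new elements of a single type S;
    -- ∃ answers with all new elements of type S on her side.
    admissible-infiniteForth : ∀ {K} → FreshCountEquiv M₀ M₁ K ā b̄ → InfiniteForth (Admissible M₀ M₁ ā b̄)
    admissible-infiniteForth equiv A ∞A =
      let (S , ∞A∩S) = Infinite⇒infiniteFibre (typeOf M₀) (allSubsets n) ∈-allSubsets
                         (Infinite-∖ (Occurs-finite ā) ∞A)
          ∞fresh₁ = to (proj₂ (equiv S)) (Infinite-mono (λ ((_ , new) , t) → t , new) ∞A∩S)
          (d , (d∈A , new) , t) = Infinite⇒nonempty ∞A∩S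
          B≐fresh₁ = Mem-χ {P = Fresh M₁ S b̄}
      in  χ (Fresh M₁ S b̄) , Infinite-mono (proj₂ B≐fresh₁) ∞fresh₁
        , λ e e∈B → d , d∈A , inj₂ (S , (t , new) , proj₁ B≐fresh₁ e∈B)

  admissible-backAndForth : ∀ {n} {M₀ M₁ : Model n} {K j} {ā : Vec (D M₀) j} {b̄ : Vec (D M₁) j} →
    FreshCountEquiv M₀ M₁ (suc K) ā b̄ → BackAndForth (Admissible M₀ M₁ ā b̄)
  admissible-backAndForth {M₀ = M₀} {M₁} {ā = ā} {b̄} equiv =
      admissible-forth M₀ M₁ {ā = ā} {b̄} equiv
    , Forth-map (Admissible-sym {M₀ = M₀} {M₁} {ā = ā} {b̄}) (admissible-forth M₁ M₀ {ā = b̄} {ā} equiv′)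
    , admissible-infiniteForth M₀ M₁ {ā = ā} {b̄} equiv
    , InfiniteForth-map (Admissible-sym {M₀ = M₀} {M₁} {ā = ā} {b̄}) (admissible-infiniteForth M₁ M₀ {ā = b̄} {ā} equiv′)
    where
    equiv′ : FreshCountEquiv M₁ M₀ _ b̄ ā
    equiv′ S = CountEquiv-sym (equiv S)

  -- WinsFrom M₀ M₁ (suc k) ā b̄ unfolds to BackAndForth of the relation
  -- "the extended position is a partial isomorphism from which ∃ wins k rounds".
  FreshCountEquiv⇒WinsFrom : ∀ {n} (M₀ M₁ : Model n) k {j} {ā : Vec (D M₀) j} {b̄ : Vec (D M₁) j} →
    FreshCountEquiv M₀ M₁ k ā b̄ → PartialIso M₀ M₁ ā b̄ → WinsFrom M₀ M₁ k ā b̄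
  FreshCountEquiv⇒WinsFrom M₀ M₁ zero    _ _ = tt
  FreshCountEquiv⇒WinsFrom M₀ M₁ (suc k) {ā = ā} {b̄} equiv iso =
    BackAndForth-map continue (admissible-backAndForth {M₀ = M₀} {M₁} {ā = ā} {b̄} equiv)
    where
    continue : ∀ {d e} → Admissible M₀ M₁ ā b̄ d e →
               PartialIso M₀ M₁ (d ∷ ā) (e ∷ b̄) × WinsFrom M₀ M₁ k (d ∷ ā) (e ∷ b̄)
    continue adm = PartialIso-∷ adm iso
                 , FreshCountEquiv⇒WinsFrom M₀ M₁ k (FreshCountEquiv-∷ M₀ M₁ adm equiv) (PartialIso-∷ adm iso)

  WinsFrom⇒⟦⟧⇔ : ∀ {n} (M₀ M₁ : Model n) {k j} (φ : Formula n j) {ā : Vec (D M₀) j} {b̄ : Vec (D M₁) j} →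
    qr φ ≤ k → PartialIso M₀ M₁ ā b̄ → WinsFrom M₀ M₁ k ā b̄ → ⟦ φ ⟧ M₀ ā ⇔ ⟦ φ ⟧ M₁ b̄
  WinsFrom⇒⟦⟧⇔ M₀ M₁ ⊤f        _ _                 _ = ⇔.refl
  WinsFrom⇒⟦⟧⇔ M₀ M₁ ⊥f        _ _                 _ = ⇔.refl
  WinsFrom⇒⟦⟧⇔ M₀ M₁ (pos a x) _ (_ , sameV)       _ = mk⇔ (trans (sym (sameV x a))) (trans (sameV x a))
  WinsFrom⇒⟦⟧⇔ M₀ M₁ (neg a x) _ (_ , sameV)       _ = mk⇔ (trans (sym (sameV x a))) (trans (sameV x a))
  WinsFrom⇒⟦⟧⇔ M₀ M₁ (eq x y)  _ (sameEq , _)      _ = sameEq x y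
  WinsFrom⇒⟦⟧⇔ M₀ M₁ (neq x y) _ (sameEq , _)      _ =
    mk⇔ (λ x≢y x≡y → x≢y (from (sameEq x y) x≡y)) (λ x≢y x≡y → x≢y (to (sameEq x y) x≡y))
  WinsFrom⇒⟦⟧⇔ M₀ M₁ (φ ∨f ψ) qr≤k iso w =
    WinsFrom⇒⟦⟧⇔ M₀ M₁ φ (m⊔n≤o⇒m≤o _ _ qr≤k) iso w ⊎-⇔ WinsFrom⇒⟦⟧⇔ M₀ M₁ ψ (m⊔n≤o⇒n≤o _ _ qr≤k) iso w
  WinsFrom⇒⟦⟧⇔ M₀ M₁ (φ ∧f ψ) qr≤k iso w =
    WinsFrom⇒⟦⟧⇔ M₀ M₁ φ (m⊔n≤o⇒m≤o _ _ qr≤k) iso w ×-⇔ WinsFrom⇒⟦⟧⇔ M₀ M₁ ψ (m⊔n≤o⇒n≤o _ _ qr≤k) iso w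
  WinsFrom⇒⟦⟧⇔ M₀ M₁ (∃f φ)  (s≤s qr≤k) _ w = ∃-⇔ w (λ (iso′ , w′) → WinsFrom⇒⟦⟧⇔ M₀ M₁ φ qr≤k iso′ w′)
  WinsFrom⇒⟦⟧⇔ M₀ M₁ (∀f φ)  (s≤s qr≤k) _ w = ∀-⇔ w (λ (iso′ , w′) → WinsFrom⇒⟦⟧⇔ M₀ M₁ φ qr≤k iso′ w′)
  WinsFrom⇒⟦⟧⇔ M₀ M₁ (∃∞f φ) (s≤s qr≤k) _ w = Infinite-⇔ w (λ (iso′ , w′) → WinsFrom⇒⟦⟧⇔ M₀ M₁ φ qr≤k iso′ w′)
  WinsFrom⇒⟦⟧⇔ M₀ M₁ (∀∞f φ) (s≤s qr≤k) _ w = Cofinite-⇔ w (λ (iso′ , w′) → WinsFrom⇒⟦⟧⇔ M₀ M₁ φ qr≤k iso′ w′)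

  module Implications {n} (M₀ M₁ : Model n) where

    SameTheory⇒FreshCountEquiv : ∀ k → SameTheory (suc k) M₀ M₁ → FreshCountEquiv M₀ M₁ (suc k) [] []
    SameTheory⇒FreshCountEquiv k sameTheory S = atLeastAgree , infiniteAgree
      where
      atLeastAgree : ∀ m → m ≤ suc k → AtLeast (Fresh M₀ S []) m ⇔ AtLeast (Fresh M₁ S []) m
      atLeastAgree m m≤ =
        ⇔.trans (⇔.sym (⟦atLeast⟧ M₀ S m []))
          (⇔.trans (sameTheory (atLeast S m) (≤-trans (≤-reflexive (qr-atLeast S m)) m≤)) (⟦atLeast⟧ M₁ S m []))
      infiniteAgree : Infinite (Fresh M₀ S []) ⇔ Infinite (Fresh M₁ S [])
      infiniteAgree =
        ⇔.trans (⇔.sym (Infinite-cong (⟦freshOfType⟧ M₀ S [])))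
          (⇔.trans (sameTheory (∃∞f (freshOfType S)) (s≤s (≤-trans (≤-reflexive (qr-freshOfType S)) z≤n)))
                   (Infinite-cong (⟦freshOfType⟧ M₁ S [])))

    Sim∞⇔FreshCountEquiv : ∀ k → Sim∞ (suc k) M₀ M₁ ⇔ FreshCountEquiv M₀ M₁ (suc k) [] []
    Sim∞⇔FreshCountEquiv k = mk⇔
      (λ sim S → CountEquiv-cong (≐-sym (Fresh-[] M₀)) (≐-sym (Fresh-[] M₁)) (CountClause⇒CountEquiv (sim S)))
      (λ equiv S → CountEquiv⇒CountClause (CountEquiv-cong (Fresh-[] M₀) (Fresh-[] M₁) (equiv S)))

    SameTheory⇒Sim∞ : ∀ k → SameTheory k M₀ M₁ → Sim∞ k M₀ M₁
    SameTheory⇒Sim∞ zero    _ = tt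
    SameTheory⇒Sim∞ (suc k) = from (Sim∞⇔FreshCountEquiv k) ∘ SameTheory⇒FreshCountEquiv k

    Sim∞⇒EFWin : ∀ k → Sim∞ k M₀ M₁ → EFWin k M₀ M₁
    Sim∞⇒EFWin zero    _   = tt
    Sim∞⇒EFWin (suc k) sim = FreshCountEquiv⇒WinsFrom M₀ M₁ (suc k) (to (Sim∞⇔FreshCountEquiv k) sim) (PartialIso-[] M₀ M₁)

    EFWin⇒SameTheory : ∀ k → EFWin k M₀ M₁ → SameTheory k M₀ M₁
    EFWin⇒SameTheory k win φ qr≤k = WinsFrom⇒⟦⟧⇔ M₀ M₁ φ qr≤k (PartialIso-[] M₀ M₁) win

proposition3p14 : ExcludedMiddle 0ℓ → ∀ {n : ℕ} (M₀ M₁ : Model n) (k : ℕ) →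
                    (SameTheory k M₀ M₁ ⇔ Sim∞ k M₀ M₁) × (Sim∞ k M₀ M₁ ⇔ EFWin k M₀ M₁)
proposition3p14 em M₀ M₁ k =
    mk⇔ (SameTheory⇒Sim∞ k) (EFWin⇒SameTheory k ∘ Sim∞⇒EFWin k)
  , mk⇔ (Sim∞⇒EFWin k) (SameTheory⇒Sim∞ k ∘ EFWin⇒SameTheory k)
  where open Classical.Implications em M₀ M₁
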